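{- Let $b\ge 2$. For every integer $n\ge 0$, the set of nodes at depth $n$ of the tree $T_b(\infty)$ is exactly $R_b(n)$, the set of all $b$-ary partitions of $n$.
   Context: A $b$-ary partition of $n\ge0$ is a sequence $p=(p_0,p_1,\dots)$ of non-negative integers, finitely many nonzero, with $\sum_j p_jb^j=n$ (written as finite tuples, trailing zeros omitted; $(0)$ is the zero sequence). Firing $j$ (allowed when $p_j\ge b$) replaces $p_j$ by $p_j-b$ and $p_{j+1}$ by $p_{j+1}+1$; $R_b(n)$ is the set of $b$-ary partitions of $n$ obtainable from $(n,0,\dots)$ by finitely many firings. For a $b$-ary partition $p$, let $l(p)$ be the largest $l\ge0$ with $p_0=\dots=p_{l-1}=b-1$, and for $0\le i\le l(p)$ let $\mathrm{inc}_i(p)=(0,\dots,0,p_i+1,p_{i+1},\dots)$ ($i$ leading zeros). The tree $T_b(\infty)$ has as nodes the elements of $\bigsqcup_{n\ge0}R_b(n)$, root $(0)$, and each node $p$ has exactly $l(p)+1$ ordered sons, the $(i+1)$-th son being $\mathrm{inc}_i(p)$ for $0\le i\le l(p)$. The depth of the root is $0$. -}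

module Defs where

open import Data.Nat using (ℕ; zero; suc; _∸_; _≤_; _<_)
open import Data.Product using (Σ; _×_; ∃-syntax)
open import Relation.Binary.PropositionalEquality using (_≡_; _≢_)

-- A sequence of non-negative integers p = (p₀, p₁, …) is a function ℕ → ℕ.
-- All predicates below are stated pointwise, so they are closed under
-- pointwise (extensional) equality of sequences.
Seq : Set
Seq = ℕ → ℕ

_≈_ : Seq → Seq → Set
p ≈ q = ∀ k → p k ≡ q k

zeroSeq : Seq
zeroSeq _ = 0

initial : ℕ → Seq
initial n zero    = n
initial n (suc _) = 0

Fire : ℕ → ℕ → Seq → Seq → Set
Fire b j p q =
  b ≤ p j
  × q j ≡ p j ∸ b
  × q (suc j) ≡ suc (p (suc j))
  × (∀ k → k ≢ j → k ≢ suc j → q k ≡ p k)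

-- InR b n q : q ∈ R_b(n), i.e. q is obtained from (n, 0, …) by
-- finitely many firings.
data InR (b n : ℕ) : Seq → Set where
  start : ∀ {q} → q ≈ initial n → InR b n q
  fire  : ∀ {p q} j → InR b n p → Fire b j p q → InR b n q

-- i ≤ l(p), where l(p) is the largest l with p₀ = … = p_{l-1} = b-1;
-- equivalently p₀ = … = p_{i-1} = b-1.
≤l : ℕ → ℕ → Seq → Set
≤l b i p = ∀ k → k < i → p k ≡ b ∸ 1

Inc : ℕ → Seq → Seq → Set
Inc i p q =
  (∀ k → k < i → q k ≡ 0)
  × q i ≡ suc (p i)
  × (∀ k → i < k → q k ≡ p k)

-- AtDepth b n q : q is a node at depth n of T_b(∞): it is reached from the
-- root (0) by a path of n father-to-son steps, the sons of p being
-- inc_i(p) for 0 ≤ i ≤ l(p).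
data AtDepth (b : ℕ) : ℕ → Seq → Set where
  root : ∀ {q} → q ≈ zeroSeq → AtDepth b 0 q
  son  : ∀ {n p q} i → AtDepth b n p → ≤l b i p → Inc i p q → AtDepth b (suc n) q

-- For j ≥ i and
-- p_j ≥ b, fire_j ∘ inc_i = inc_i ∘ fire_j; and if p_i = b - 1, then
-- fire_i (inc_i p) = inc_(i+1) p.  The second identity builds each son
-- inc_(i+1) p from inc_i p by one firing, and inc_0 lifts a whole firing
-- sequence for n to one for n + 1, so every node at depth n lies in R_b(n).
-- Conversely (n, 0, …) = inc_0ⁿ (0) is at depth n, and the nodes at a fixed
-- depth are closed under firing.  Firing p = inc_i p' at j < i is impossible
-- because p_j = 0.  Firing at j ≥ i either commutes with inc_i, or we have
-- j = i and p'_i = b - 1, in which case the result is the sibling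
-- inc_(i+1) p'.
module Submission where

open import Defs
open import Data.Nat using (ℕ; zero; suc; _∸_; _≤_; _<_; _>_; z≤n; s≤s; _≤?_; _≟_)
open import Data.Nat.Properties
open import Data.Product using (_,_)
open import Data.Sum using (inj₁; inj₂)
open import Data.Empty using (⊥-elim)
open import Function using (_∘_)
open import Function.Bundles using (_⇔_; mk⇔)
open import Relation.Binary using (Setoid; tri<; tri≈; tri>)
open import Relation.Binary.PropositionalEquality
  using (_≡_; _≢_; refl; sym; trans; cong; subst; _→-setoid_)
open import Relation.Nullary using (yes; no)

open Setoid (ℕ →-setoid ℕ) using () renaming (sym to ≈-sym; trans to ≈-trans)
open import Relation.Binary.Reasoning.Setoid (ℕ →-setoid ℕ) using (begin_; step-≈-⟩; _∎)

initial-zero : initial 0 ≈ zeroSeq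
initial-zero zero    = refl
initial-zero (suc k) = refl

incAt : ℕ → Seq → Seq
incAt zero    p zero    = suc (p zero)
incAt zero    p (suc k) = p (suc k)
incAt (suc i) p zero    = 0
incAt (suc i) p (suc k) = incAt i (p ∘ suc) k

incAt-below : ∀ {i k} p → k < i → incAt i p k ≡ 0
incAt-below {suc i} {zero}  p _         = refl
incAt-below {suc i} {suc k} p (s≤s k<i) = incAt-below (p ∘ suc) k<i

incAt-at : ∀ i p → incAt i p i ≡ suc (p i)
incAt-at zero    p = refl
incAt-at (suc i) p = incAt-at i (p ∘ suc)

incAt-above : ∀ {i k} p → i < k → incAt i p k ≡ p k
incAt-above {zero}  {suc k} p _         = refl
incAt-above {suc i} {suc k} p (s≤s i<k) = incAt-above (p ∘ suc) i<k

Inc-incAt : ∀ i p → Inc i p (incAt i p)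
Inc-incAt i p = (λ _ → incAt-below p) , incAt-at i p , λ _ → incAt-above p

Inc⇒≈incAt : ∀ {i p q} → Inc i p q → q ≈ incAt i p
Inc⇒≈incAt {i} {p} (below , at , above) k with <-cmp k i
... | tri< k<i _ _ = trans (below k k<i) (sym (incAt-below p k<i))
... | tri≈ _ refl _ = trans at (sym (incAt-at k p))
... | tri> _ _ i<k = trans (above k i<k) (sym (incAt-above p i<k))

incAt-cong : ∀ i {p q} → p ≈ q → incAt i p ≈ incAt i q
incAt-cong zero    p≈q zero    = cong suc (p≈q zero)
incAt-cong zero    p≈q (suc k) = p≈q (suc k)
incAt-cong (suc i) p≈q zero    = refl
incAt-cong (suc i) p≈q (suc k) = incAt-cong i (p≈q ∘ suc) k

incAt₀-≥ : ∀ p k → p k ≤ incAt 0 p k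
incAt₀-≥ p zero    = n≤1+n (p zero)
incAt₀-≥ p (suc k) = ≤-refl

incAt₀-initial : ∀ n → incAt 0 (initial n) ≈ initial (suc n)
incAt₀-initial n zero    = refl
incAt₀-initial n (suc k) = refl

module _ {b : ℕ} where

  fireAt : ℕ → Seq → Seq
  fireAt zero    p zero          = p zero ∸ b
  fireAt zero    p (suc zero)    = suc (p 1)
  fireAt zero    p (suc (suc k)) = p (suc (suc k))
  fireAt (suc j) p zero          = p zero
  fireAt (suc j) p (suc k)       = fireAt j (p ∘ suc) k

  fireAt-at : ∀ j p → fireAt j p j ≡ p j ∸ b
  fireAt-at zero    p = refl
  fireAt-at (suc j) p = fireAt-at j (p ∘ suc)

  fireAt-next : ∀ j p → fireAt j p (suc j) ≡ suc (p (suc j))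
  fireAt-next zero    p = refl
  fireAt-next (suc j) p = fireAt-next j (p ∘ suc)

  fireAt-other : ∀ {j k} p → k ≢ j → k ≢ suc j → fireAt j p k ≡ p k
  fireAt-other {zero}  {zero}        p k≢j _   = ⊥-elim (k≢j refl)
  fireAt-other {zero}  {suc zero}    p _   k≢1 = ⊥-elim (k≢1 refl)
  fireAt-other {zero}  {suc (suc k)} p _   _   = refl
  fireAt-other {suc j} {zero}        p _   _   = refl
  fireAt-other {suc j} {suc k}       p k≢j k≢j+1 =
    fireAt-other (p ∘ suc) (k≢j ∘ cong suc) (k≢j+1 ∘ cong suc)

  fireAt-below : ∀ {j k} p → k < j → fireAt j p k ≡ p k
  fireAt-below p k<j = fireAt-other p (<⇒≢ k<j) (<⇒≢ (m<n⇒m<1+n k<j))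

  Fire-fireAt : ∀ {j p} → b ≤ p j → Fire b j p (fireAt j p)
  Fire-fireAt {j} {p} b≤pj =
    b≤pj , fireAt-at j p , fireAt-next j p , λ _ → fireAt-other p

  Fire⇒≈fireAt : ∀ {j p q} → Fire b j p q → q ≈ fireAt j p
  Fire⇒≈fireAt {j} {p} (_ , at , next , other) k with k ≟ j | k ≟ suc j
  ... | yes refl | _        = trans at (sym (fireAt-at k p))
  ... | no _     | yes refl = trans next (sym (fireAt-next j p))
  ... | no k≢j   | no k≢j+1 =
    trans (other k k≢j k≢j+1) (sym (fireAt-other p k≢j k≢j+1))

  fireAt-cong : ∀ j {p q} → p ≈ q → fireAt j p ≈ fireAt j q
  fireAt-cong zero    p≈q zero          = cong (_∸ b) (p≈q zero)
  fireAt-cong zero    p≈q (suc zero)    = cong suc (p≈q 1)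
  fireAt-cong zero    p≈q (suc (suc k)) = p≈q (suc (suc k))
  fireAt-cong (suc j) p≈q zero          = p≈q zero
  fireAt-cong (suc j) p≈q (suc k)       = fireAt-cong j (p≈q ∘ suc) k

  fireAt-incAt-comm : ∀ {i j p} → i ≤ j → b ≤ p j →
                      fireAt j (incAt i p) ≈ incAt i (fireAt j p)
  fireAt-incAt-comm {zero}  {zero}  _         b≤p0 zero          = +-∸-assoc 1 b≤p0
  fireAt-incAt-comm {zero}  {zero}  _         _    (suc zero)    = refl
  fireAt-incAt-comm {zero}  {zero}  _         _    (suc (suc k)) = refl
  fireAt-incAt-comm {zero}  {suc j} _         _    zero          = refl
  fireAt-incAt-comm {zero}  {suc j} _         _    (suc k)       = refl
  fireAt-incAt-comm {suc i} {suc j} _         _    zero          = refl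
  fireAt-incAt-comm {suc i} {suc j} (s≤s i≤j) b≤pj (suc k)       = fireAt-incAt-comm i≤j b≤pj k

  fireAt-incAt-carry : ∀ i {p} → suc (p i) ≡ b →
                       fireAt i (incAt i p) ≈ incAt (suc i) p
  fireAt-incAt-carry zero    pi+1≡b zero          = trans (cong (_∸ b) pi+1≡b) (n∸n≡0 b)
  fireAt-incAt-carry zero    _      (suc zero)    = refl
  fireAt-incAt-carry zero    _      (suc (suc k)) = refl
  fireAt-incAt-carry (suc i) _      zero          = refl
  fireAt-incAt-carry (suc i) pi+1≡b (suc k)       = fireAt-incAt-carry i pi+1≡b k

  ≤l-fireAt : ∀ {i j p} → i ≤ j → ≤l b i p → ≤l b i (fireAt j p)
  ≤l-fireAt {p = p} i≤j l k k<i = trans (fireAt-below p (<-≤-trans k<i i≤j)) (l k k<i)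

  ≤l-pred : ∀ {i p} → ≤l b (suc i) p → ≤l b i p
  ≤l-pred l k k<i = l k (m<n⇒m<1+n k<i)

  ≤l-suc : ∀ {i p} → ≤l b i p → p i ≡ b ∸ 1 → ≤l b (suc i) p
  ≤l-suc l pi≡b-1 k k<i+1 with m<1+n⇒m<n∨m≡n k<i+1
  ... | inj₁ k<i  = l k k<i
  ... | inj₂ refl = pi≡b-1

  InR-resp-≈ : ∀ {n p q} → p ≈ q → InR b n p → InR b n q
  InR-resp-≈ p≈q (start p≈init) = start (≈-trans (≈-sym p≈q) p≈init)
  InR-resp-≈ p≈q (fire j r (b≤ , at , next , other)) =
    fire j r ( b≤
             , trans (sym (p≈q j)) at
             , trans (sym (p≈q (suc j))) next
             , λ k k≢j k≢j+1 → trans (sym (p≈q k)) (other k k≢j k≢j+1))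

  AtDepth-resp-≈ : ∀ {n p q} → p ≈ q → AtDepth b n p → AtDepth b n q
  AtDepth-resp-≈ p≈q (root p≈0) = root (≈-trans (≈-sym p≈q) p≈0)
  AtDepth-resp-≈ p≈q (son i d l (below , at , above)) =
    son i d l ( (λ k k<i → trans (sym (p≈q k)) (below k k<i))
              , trans (sym (p≈q i)) at
              , λ k i<k → trans (sym (p≈q k)) (above k i<k))

  InR-fireAt : ∀ {n j p} → InR b n p → b ≤ p j → InR b n (fireAt j p)
  InR-fireAt {j = j} r b≤pj = fire j r (Fire-fireAt b≤pj)

  InR-incAt₀ : ∀ {n p} → InR b n p → InR b (suc n) (incAt 0 p)
  InR-incAt₀ {n} (start p≈init) = start (≈-trans (incAt-cong 0 p≈init) (incAt₀-initial n))
  InR-incAt₀ {p = q} (fire {p = p} j r f@(b≤pj , _)) =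
    InR-resp-≈ fired≈
      (InR-fireAt {j = j} (InR-incAt₀ r) (≤-trans b≤pj (incAt₀-≥ p j)))
    where
    fired≈ : fireAt j (incAt 0 p) ≈ incAt 0 q
    fired≈ = begin
      fireAt j (incAt 0 p)  ≈⟨ fireAt-incAt-comm {j = j} {p} z≤n b≤pj ⟩
      incAt 0 (fireAt j p)  ≈⟨ incAt-cong 0 (≈-sym (Fire⇒≈fireAt f)) ⟩
      incAt 0 q             ∎

  InR-incAt : ∀ {n i p} → b > 0 → InR b n p → ≤l b i p → InR b (suc n) (incAt i p)
  InR-incAt {i = zero}      _   r _ = InR-incAt₀ r
  InR-incAt {i = suc i} {p} b>0 r l =
    InR-resp-≈ (fireAt-incAt-carry i pi+1≡b)
      (InR-fireAt (InR-incAt b>0 r (≤l-pred l))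
                  (≤-reflexive (sym (trans (incAt-at i p) pi+1≡b))))
    where
    pi+1≡b : suc (p i) ≡ b
    pi+1≡b = trans (cong suc (l i ≤-refl)) (m+[n∸m]≡n b>0)

  AtDepth⇒InR : ∀ {n p} → b > 0 → AtDepth b n p → InR b n p
  AtDepth⇒InR _   (root p≈0)     = start (≈-trans p≈0 (≈-sym initial-zero))
  AtDepth⇒InR b>0 (son i d l inc) =
    InR-resp-≈ (≈-sym (Inc⇒≈incAt inc)) (InR-incAt b>0 (AtDepth⇒InR b>0 d) l)

  AtDepth-incAt : ∀ {n i p} → AtDepth b n p → ≤l b i p → AtDepth b (suc n) (incAt i p)
  AtDepth-incAt {i = i} {p} d l = son i d l (Inc-incAt i p)

  AtDepth-initial : ∀ n → AtDepth b n (initial n)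
  AtDepth-initial zero    = root initial-zero
  AtDepth-initial (suc n) =
    AtDepth-resp-≈ (incAt₀-initial n) (AtDepth-incAt {i = 0} (AtDepth-initial n) λ _ ())

  AtDepth-fireAt : ∀ {n j p} → b > 0 → AtDepth b n p → b ≤ p j → AtDepth b n (fireAt j p)
  AtDepth-fireAt {j = j} b>0 (root p≈0) b≤pj =
    ⊥-elim (<⇒≱ b>0 (subst (b ≤_) (p≈0 j) b≤pj))
  AtDepth-fireAt {j = j} b>0 (son {p = p} i d l inc) b≤qj =
    AtDepth-resp-≈ (fireAt-cong j (≈-sym (Inc⇒≈incAt inc)))
      (fire-son (subst (b ≤_) (Inc⇒≈incAt inc j) b≤qj))
    where
    commute : i ≤ j → b ≤ p j → AtDepth b _ (fireAt j (incAt i p))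
    commute i≤j b≤pj = AtDepth-resp-≈ (≈-sym (fireAt-incAt-comm i≤j b≤pj))
                       (AtDepth-incAt (AtDepth-fireAt b>0 d b≤pj) (≤l-fireAt i≤j l))

    fire-son : b ≤ incAt i p j → AtDepth b _ (fireAt j (incAt i p))
    fire-son b≤inc with <-cmp j i
    ... | tri< j<i _ _ = ⊥-elim (<⇒≱ b>0 (subst (b ≤_) (incAt-below p j<i) b≤inc))
    ... | tri> _ _ i<j = commute (<⇒≤ i<j) (subst (b ≤_) (incAt-above p i<j) b≤inc)
    ... | tri≈ _ refl _ with b ≤? p j
    ...   | yes b≤pj = commute ≤-refl b≤pj
    ...   | no  b≰pj = AtDepth-resp-≈ (≈-sym (fireAt-incAt-carry j pj+1≡b))
                       (AtDepth-incAt d (≤l-suc l (cong (_∸ 1) pj+1≡b)))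
      where
      pj+1≡b : suc (p j) ≡ b
      pj+1≡b = ≤-antisym (≰⇒> b≰pj) (subst (b ≤_) (incAt-at j p) b≤inc)

  InR⇒AtDepth : ∀ {n p} → b > 0 → InR b n p → AtDepth b n p
  InR⇒AtDepth {n} _   (start p≈init) = AtDepth-resp-≈ (≈-sym p≈init) (AtDepth-initial n)
  InR⇒AtDepth     b>0 (fire j r f@(b≤pj , _)) =
    AtDepth-resp-≈ (≈-sym (Fire⇒≈fireAt f)) (AtDepth-fireAt b>0 (InR⇒AtDepth b>0 r) b≤pj)

proposition1 : (b : ℕ) → 2 ≤ b → (n : ℕ) → (p : Seq) → AtDepth b n p ⇔ InR b n p
proposition1 b 2≤b n p = mk⇔ (AtDepth⇒InR b>0) (InR⇒AtDepth b>0)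
  where
  b>0 : b > 0
  b>0 = ≤-trans (n≤1+n 1) 2≤b
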